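{- Let $T = [(\texttt{@\$},1), (\sigma_1,p_1), \ldots, (\sigma_{k-1},p_{k-1})]$ be a sequence of bilateral tokens with $k \ge 2$, all of whose characters other than those of the first token lie in $\Sigma$. For each $1 \le d \le k-2$ write $a_d = \sigma_d[1]$ and $c_d = \sigma_d[|\sigma_d|]$. Then $T$ lies in the image of $\mathcal{F}$ (i.e. $T = \mathcal{F}(s)$ for some $s\in\Sigma^*$) if and only if: (1) for each $1 \le d \le k-2$: $p_d \ge 1$ and $|\sigma_d| - p_d \ge 1$, the front part $\sigma_d[1..p_d]$ is a single run of $a_d$, and the back part $\sigma_d[p_d+1..|\sigma_d|]$ is a single run of $c_d$; (2) $p_{k-1} = 0$ and $\sigma_{k-1}$ is either a single run $a^m$ or two adjacent runs $a^\ell c^b$ with $a \ne c$; (3) if $k \ge 3$: for $1 \le d \le k-3$, $a_{d+1}\ne a_d$ and $c_{d+1} \ne c_d$; and the first character of $\sigma_{k-1}$ differs from $a_{k-2}$ and the last character of $\sigma_{k-1}$ differs from $c_{k-2}$. (When $k = 2$ only conditions (1) and (2) apply.) Moreover, $\mathcal{F}(\mathcal{F}^{ -1}(T)) = T$ for every $T$ satisfying these conditions.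
   Context: Let $\Sigma$ be an alphabet and let $\texttt{@}$ and $\texttt{\$}$ be two distinct symbols not in $\Sigma$; $a^m$ denotes $a$ repeated $m$ times, and a run is a non-empty string consisting of one repeated symbol. A bilateral token is a pair $(\sigma,p)$ with $\sigma$ a non-empty string and $p\in\mathbb{N}_0$. For $s\in\Sigma^*$ let $\hat{s} = \texttt{@}\,s\,\texttt{\$}$. The leading (resp. trailing) run of a non-empty string is its longest prefix (resp. suffix) consisting of a single repeated symbol. The Flashback decomposition $\mathcal{F}(s)$ is produced starting with active span $\hat{s}$: (i) if the span is empty, stop; (ii) let $\ell$ be its leading run length; if $\ell$ equals the span length, append (span, $0$) and stop; (iii) otherwise let $\sigma$ be the leading run followed by the trailing run and the middle the span with both removed; if the middle is empty append $(\sigma,0)$ and stop, else append $(\sigma,\ell)$ and continue on the middle. For $T = [(\sigma_0,p_0),\ldots,(\sigma_{k-1},p_{k-1})]$, define $N_{k-1}=\sigma_{k-1}$ and $N_i = \sigma_i[1..p_i]\cdot N_{i+1}\cdot\sigma_i[p_i+1..|\sigma_i|]$ for $i<k-1$; $\mathcal{F}^{ -1}(T)$ is $N_0$ with its first and last characters removed. -}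

module Defs where

open import Data.Nat using (ℕ; zero; suc; _+_; _∸_; _≤_)
import Data.Nat as ℕ
open import Data.List using (List; []; _∷_; _++_; [_]; take; drop; length; reverse; replicate; map; _∷ʳ_)
open import Data.List.Relation.Unary.All using (All)
open import Data.List.Relation.Unary.Linked using (Linked)
open import Data.Maybe using (Maybe; just; nothing)
open import Data.Product using (_×_; _,_; proj₁; proj₂; ∃; ∃-syntax)
open import Data.Sum using (_⊎_)
open import Relation.Nullary using (¬_; yes; no)
open import Relation.Binary.PropositionalEquality using (_≡_; _≢_; refl)
open import Relation.Binary.Definitions using (DecidableEquality)

data Sym (A : Set) : Set where
  at     : Sym A
  dollar : Sym A
  ch     : A → Sym A

-- A bilateral token (σ , p); non-emptiness of σ is imposed as a hypothesis where needed.
Token : Set → Set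
Token B = List B × ℕ

first : {B : Set} → List B → Maybe B
first []      = nothing
first (x ∷ _) = just x

lastChar : {B : Set} → List B → Maybe B
lastChar xs = first (reverse xs)

dropLast : {B : Set} → List B → List B
dropLast []           = []
dropLast (x ∷ [])     = []
dropLast (x ∷ y ∷ ys) = x ∷ dropLast (y ∷ ys)

RunOf : {B : Set} → B → List B → Set
RunOf a xs = ∃[ m ] (1 ≤ m × xs ≡ replicate m a)

IsRun : {B : Set} → List B → Set
IsRun xs = ∃[ a ] RunOf a xs

module _ {A : Set} (_≟A_ : DecidableEquality A) where

  _≟S_ : DecidableEquality (Sym A)
  at ≟S at = yes refl
  at ≟S dollar = no (λ ())
  at ≟S ch _ = no (λ ())
  dollar ≟S at = no (λ ())
  dollar ≟S dollar = yes refl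
  dollar ≟S ch _ = no (λ ())
  ch _ ≟S at = no (λ ())
  ch _ ≟S dollar = no (λ ())
  ch x ≟S ch y with x ≟A y
  ... | yes refl = yes refl
  ... | no x≢y = no (λ { refl → x≢y refl })

  runFrom : Sym A → List (Sym A) → ℕ
  runFrom x [] = 0
  runFrom x (y ∷ ys) with x ≟S y
  ... | yes _ = suc (runFrom x ys)
  ... | no _  = 0

  leadLen : List (Sym A) → ℕ
  leadLen []       = 0
  leadLen (x ∷ xs) = suc (runFrom x xs)

  trailLen : List (Sym A) → ℕ
  trailLen xs = leadLen (reverse xs)

  -- the Flashback decomposition of an active span, with fuel (fuel = span length suffices)
  decomp : ℕ → List (Sym A) → List (Token (Sym A))
  decomp zero    _  = []
  decomp (suc n) [] = []
  decomp (suc n) xs@(_ ∷ _) with leadLen xs ℕ.≟ length xs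
  ... | yes _ = (xs , 0) ∷ []
  ... | no  _ with drop (leadLen xs) (take (length xs ∸ trailLen xs) xs)
  ...   | []          = (take (leadLen xs) xs ++ drop (length xs ∸ trailLen xs) xs , 0) ∷ []
  ...   | mid@(_ ∷ _) = (take (leadLen xs) xs ++ drop (length xs ∸ trailLen xs) xs , leadLen xs)
                          ∷ decomp n mid

  hat : List (Sym A) → List (Sym A)
  hat u = at ∷ (u ∷ʳ dollar)

  Fsym : List (Sym A) → List (Token (Sym A))
  Fsym u = decomp (length (hat u)) (hat u)

  F : List A → List (Token (Sym A))
  F s = Fsym (map ch s)

nest : {B : Set} → List (Token B) → List B
nest []                  = []
nest ((σ , p) ∷ [])      = σ
nest ((σ , p) ∷ t ∷ ts)  = take p σ ++ nest (t ∷ ts) ++ drop p σ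

Finv : {B : Set} → List (Token B) → List B
Finv T = dropLast (drop 1 (nest T))

embTok : {A : Set} → Token A → Token (Sym A)
embTok (σ , p) = (map ch σ , p)

-- T = [(@$,1), (σ_1,p_1), …, (σ_{k-2},p_{k-2}), (σ_{k-1},p_{k-1})]
-- with mids = [(σ_1,p_1), …, (σ_{k-2},p_{k-2})] and lastTok = (σ_{k-1},p_{k-1})
tokSeq : {A : Set} → List (Token A) → Token A → List (Token (Sym A))
tokSeq mids lastTok = ((at ∷ dollar ∷ []) , 1) ∷ map embTok (mids ++ [ lastTok ])

Cond1Tok : {A : Set} → Token A → Set
Cond1Tok {A} (σ , p) =
  ∃[ a ] ∃[ c ] (first σ ≡ just a × lastChar σ ≡ just c
    × 1 ≤ p × 1 ≤ length σ ∸ p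
    × RunOf a (take p σ) × RunOf c (drop p σ))

Cond1 : {A : Set} → List (Token A) → Set
Cond1 mids = All Cond1Tok mids

Cond2 : {A : Set} → Token A → Set
Cond2 {A} (σ , p) =
  p ≡ 0 × (IsRun σ ⊎ ∃[ a ] ∃[ c ] ∃[ ℓ ] ∃[ b ]
            (a ≢ c × 1 ≤ ℓ × 1 ≤ b × σ ≡ replicate ℓ a ++ replicate b c))

Adjacent : {A : Set} → Token A → Token A → Set
Adjacent (σ , _) (σ' , _) = first σ' ≢ first σ × lastChar σ' ≢ lastChar σ

-- Condition (3): a_{d+1} ≠ a_d, c_{d+1} ≠ c_d for 1 ≤ d ≤ k-3, and the last token's
-- first/last characters differ from a_{k-2}/c_{k-2}; vacuous when k = 2.
Cond3 : {A : Set} → List (Token A) → Token A → Set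
Cond3 mids lastTok = Linked Adjacent (mids ++ [ lastTok ])

Conds : {A : Set} → List (Token A) → Token A → Set
Conds mids lastTok = Cond1 mids × Cond2 lastTok × Cond3 mids lastTok

NonEmptyTok : {A : Set} → Token A → Set
NonEmptyTok (σ , _) = σ ≢ []

{-# OPTIONS --safe #-}

-- Call a token list admissible if its last token has the shape (2), every other token the
-- shape (1), and neighbours satisfy (3); the conditions of the theorem say exactly that the
-- tokens after (@$,1) form an admissible list. Two facts about nesting carry the proof.
-- Every non-empty string is the nesting of an admissible list: peel off its maximal leading
-- and trailing runs and recurse on the middle. Conversely, for admissible T the Flashback
-- decomposition of nest T is T again, because condition (3) makes the two runs of each token
-- maximal in the span they enclose. Prefixing (@$,1) keeps a list over Σ admissible and turns
-- nest T into @ (nest T) $, so 𝓕 (nest T) = (@$,1) ∷ T. With injectivity of the embedding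
-- Σ → Σ ∪ {@,$} this gives both directions of the equivalence, and the round trip follows
-- because 𝓕⁻¹ ((@$,1) ∷ T) = nest T.

module Submission where

open import Defs
open import Data.List using (List; []; _∷_; _++_; [_]; take; drop; length; reverse; replicate; map; _∷ʳ_)
open import Data.List.Properties using (++-assoc; ++-identityʳ; map-++; length-++; length-++-≤ˡ; length-++-≤ʳ; length-take; take-map; drop-map; take++drop≡id; length-replicate; map-replicate; reverse-++; reverse-involutive; reverse-map; unfold-reverse; map-injective; ∷-injectiveʳ)
open import Data.List.Relation.Unary.Linked using ([]; [-]; _∷_)
open import Data.List.Relation.Unary.All using (All; []; _∷_)
open import Data.Maybe using (just; nothing)
import Data.Maybe as Maybe
import Data.Maybe.Properties as Maybe
open import Data.Nat using (ℕ; zero; suc; _+_; _∸_; _⊓_; _≤_; _<_; z≤n; s≤s)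
import Data.Nat as ℕ
open import Data.Nat.Induction using (<-wellFounded)
open import Data.Nat.Properties using (≤-refl; ≤-trans; <⇒≤; <⇒≢; n>0⇒n≢0; m<m+n; m+n∸n≡m; m+n∸m≡n; m≤n⇒m⊓n≡m; m∸n≢0⇒n<m)
open import Data.Product using (_×_; _,_; proj₁; proj₂; map₁; ∃-syntax)
open import Data.Sum using (inj₁; inj₂)
open import Data.Empty using (⊥-elim)
open import Function.Bundles using (_⇔_; mk⇔)
open import Function.Definitions using (Injective)
open import Induction.WellFounded using (Acc; acc)
open import Relation.Nullary using (yes; no)
open import Relation.Binary.PropositionalEquality using (_≡_; _≢_; refl; sym; trans; cong; cong₂; subst; module ≡-Reasoning)
open import Relation.Binary.Definitions using (DecidableEquality)

module _ {B : Set} where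

  take-length-++ : (xs ys : List B) → take (length xs) (xs ++ ys) ≡ xs
  take-length-++ []       ys = refl
  take-length-++ (x ∷ xs) ys = cong (x ∷_) (take-length-++ xs ys)

  drop-length-++ : (xs ys : List B) → drop (length xs) (xs ++ ys) ≡ ys
  drop-length-++ []       ys = refl
  drop-length-++ (x ∷ xs) ys = drop-length-++ xs ys

  length-++-∸ : (xs ys : List B) → length (xs ++ ys) ∸ length ys ≡ length xs
  length-++-∸ xs ys = trans (cong (_∸ length ys) (length-++ xs)) (m+n∸n≡m (length xs) (length ys))

  replicate-∷ʳ : ∀ n (x : B) → replicate n x ∷ʳ x ≡ x ∷ replicate n x
  replicate-∷ʳ zero    x = refl
  replicate-∷ʳ (suc n) x = cong (x ∷_) (replicate-∷ʳ n x)

  reverse-replicate : ∀ n (x : B) → reverse (replicate n x) ≡ replicate n x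
  reverse-replicate zero    x = refl
  reverse-replicate (suc n) x = begin
    reverse (x ∷ replicate n x)  ≡⟨ unfold-reverse x (replicate n x) ⟩
    reverse (replicate n x) ∷ʳ x ≡⟨ cong (_∷ʳ x) (reverse-replicate n x) ⟩
    replicate n x ∷ʳ x           ≡⟨ replicate-∷ʳ n x ⟩
    x ∷ replicate n x            ∎
    where open ≡-Reasoning

  reverse-++-replicate : ∀ (xs : List B) n x → reverse (xs ++ replicate n x) ≡ replicate n x ++ reverse xs
  reverse-++-replicate xs n x = trans (reverse-++ xs (replicate n x)) (cong (_++ reverse xs) (reverse-replicate n x))

  lastChar-++-replicate : ∀ (xs : List B) n x → lastChar (xs ++ replicate (suc n) x) ≡ just x
  lastChar-++-replicate xs n x = cong first (reverse-++-replicate xs (suc n) x)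

  first-++ : (xs ys : List B) → xs ≢ [] → first (xs ++ ys) ≡ first xs
  first-++ []      ys xs≢[] = ⊥-elim (xs≢[] refl)
  first-++ (_ ∷ _) ys _     = refl

  lastChar-++ : (xs ys : List B) → ys ≢ [] → lastChar (xs ++ ys) ≡ lastChar ys
  lastChar-++ xs ys ys≢[] = trans (cong first (reverse-++ xs ys))
    (first-++ (reverse ys) (reverse xs) (λ e → ys≢[] (trans (sym (reverse-involutive ys)) (cong reverse e))))

  length-≤-infix : (xs ys zs : List B) → length ys ≤ length (xs ++ ys ++ zs)
  length-≤-infix xs ys zs = ≤-trans (length-++-≤ˡ ys) (length-++-≤ʳ (ys ++ zs) {xs})

  dropLast-∷ʳ : (xs : List B) (x : B) → dropLast (xs ∷ʳ x) ≡ xs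
  dropLast-∷ʳ []          x = refl
  dropLast-∷ʳ (y ∷ [])    x = refl
  dropLast-∷ʳ (y ∷ z ∷ zs) x = cong (y ∷_) (dropLast-∷ʳ (z ∷ zs) x)

module _ {B C : Set} (f : B → C) where

  first-map : (xs : List B) → first (map f xs) ≡ Maybe.map f (first xs)
  first-map []      = refl
  first-map (_ ∷ _) = refl

  lastChar-map : (xs : List B) → lastChar (map f xs) ≡ Maybe.map f (lastChar xs)
  lastChar-map xs = trans (cong first (sym (reverse-map f xs))) (first-map (reverse xs))

  map-runs : ∀ l (a : B) b c → map f (replicate l a ++ replicate b c) ≡ replicate l (f a) ++ replicate b (f c)
  map-runs l a b c = trans (map-++ f (replicate l a) (replicate b c)) (cong₂ _++_ (map-replicate f l a) (map-replicate f b c))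

data Admissible {B : Set} : List (Token B) → Set where
  final  : ∀ {t} → Cond2 t → Admissible (t ∷ [])
  _∷⟨_⟩_ : ∀ {t t′ ts} → Cond1Tok t → Adjacent t t′ → Admissible (t′ ∷ ts) → Admissible (t ∷ t′ ∷ ts)

Conds⇒Admissible : ∀ {B} (mids : List (Token B)) lst → Conds mids lst → Admissible (mids ++ [ lst ])
Conds⇒Admissible []             lst (_ , c2 , _) = final c2
Conds⇒Admissible (m ∷ [])       lst (c1 ∷ [] , c2 , adj ∷ _) = c1 ∷⟨ adj ⟩ final c2
Conds⇒Admissible (m ∷ m′ ∷ ms) lst (c1 ∷ cs , c2 , adj ∷ lk) =
  c1 ∷⟨ adj ⟩ Conds⇒Admissible (m′ ∷ ms) lst (cs , c2 , lk)

Admissible⇒Conds : ∀ {B} (mids : List (Token B)) lst → Admissible (mids ++ [ lst ]) → Conds mids lst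
Admissible⇒Conds []             lst (final c2) = [] , c2 , [-]
Admissible⇒Conds (m ∷ [])       lst (c1 ∷⟨ adj ⟩ final c2) = c1 ∷ [] , c2 , adj ∷ [-]
Admissible⇒Conds (m ∷ m′ ∷ ms) lst (c1 ∷⟨ adj ⟩ adm) =
  let cs , c2 , lk = Admissible⇒Conds (m′ ∷ ms) lst adm in c1 ∷ cs , c2 , adj ∷ lk

module _ {B : Set} where

  runs : ℕ → B → ℕ → B → List B
  runs l a b c = replicate (suc l) a ++ replicate (suc b) c

  length-runs : ∀ l (a : B) b c → length (runs l a b c) ≡ suc l + suc b
  length-runs l a b c = trans (length-++ (replicate (suc l) a)) (cong₂ _+_ (length-replicate (suc l)) (length-replicate (suc b)))

  take-runs : ∀ l (a : B) b c → take (suc l) (runs l a b c) ≡ replicate (suc l) a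
  take-runs l a b c = subst (λ k → take k (runs l a b c) ≡ replicate (suc l) a) (length-replicate (suc l))
    (take-length-++ (replicate (suc l) a) (replicate (suc b) c))

  drop-runs : ∀ l (a : B) b c → drop (suc l) (runs l a b c) ≡ replicate (suc b) c
  drop-runs l a b c = subst (λ k → drop k (runs l a b c) ≡ replicate (suc b) c) (length-replicate (suc l))
    (drop-length-++ (replicate (suc l) a) (replicate (suc b) c))

  Cond1Tok-runs : ∀ l (a : B) b c → Cond1Tok (runs l a b c , suc l)
  Cond1Tok-runs l a b c =
    a , c , refl , lastChar-++-replicate (replicate (suc l) a) b c , s≤s z≤n , back-nonempty ,
    (suc l , s≤s z≤n , take-runs l a b c) , (suc b , s≤s z≤n , drop-runs l a b c)
    where
    back-nonempty : 1 ≤ length (runs l a b c) ∸ suc l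
    back-nonempty = subst (λ k → 1 ≤ k ∸ suc l) (sym (length-runs l a b c))
      (subst (1 ≤_) (sym (m+n∸m≡n (suc l) (suc b))) (s≤s z≤n))

  Cond1Tok⇒runs : ∀ {σ : List B} {p} → Cond1Tok (σ , p) → ∃[ a ] ∃[ c ] ∃[ l ] ∃[ b ] ((σ , p) ≡ (runs l a b c , suc l))
  Cond1Tok⇒runs {σ} {p} (a , c , _ , _ , _ , back , (suc l , _ , front≡) , (suc b , _ , back≡)) =
    a , c , l , b , cong₂ _,_ σ≡ p≡
    where
    open ≡-Reasoning
    σ≡ : σ ≡ runs l a b c
    σ≡ = trans (sym (take++drop≡id p σ)) (cong₂ _++_ front≡ back≡)
    p≡ : p ≡ suc l
    p≡ = begin
      p                           ≡⟨ sym (m≤n⇒m⊓n≡m (<⇒≤ (m∸n≢0⇒n<m (n>0⇒n≢0 back)))) ⟩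
      p ⊓ length σ                ≡⟨ sym (length-take p σ) ⟩
      length (take p σ)           ≡⟨ cong length front≡ ⟩
      length (replicate (suc l) a) ≡⟨ length-replicate (suc l) ⟩
      suc l                       ∎

  nest-runs : ∀ l (a : B) b c t ts →
    nest ((runs l a b c , suc l) ∷ t ∷ ts) ≡ replicate (suc l) a ++ nest (t ∷ ts) ++ replicate (suc b) c
  nest-runs l a b c t ts = cong₂ (λ u v → u ++ nest (t ∷ ts) ++ v) (take-runs l a b c) (drop-runs l a b c)

  nest-nonempty : ∀ {T : List (Token B)} → Admissible T → nest T ≢ []
  nest-nonempty (final (_ , inj₁ (_ , suc _ , _ , refl)))                = λ ()
  nest-nonempty (final (_ , inj₂ (_ , _ , suc _ , _ , _ , _ , _ , refl))) = λ ()
  nest-nonempty (c1 ∷⟨ _ ⟩ _) with Cond1Tok⇒runs c1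
  ... | _ , _ , _ , _ , refl = λ ()

  nest-ends : ∀ {σ : List B} {p ts} → Admissible ((σ , p) ∷ ts) →
    first (nest ((σ , p) ∷ ts)) ≡ first σ × lastChar (nest ((σ , p) ∷ ts)) ≡ lastChar σ
  nest-ends (final _) = refl , refl
  nest-ends {ts = t ∷ ts} (c1 ∷⟨ _ ⟩ _) with Cond1Tok⇒runs c1
  ... | a , c , l , b , refl = cong first (nest-runs l a b c t ts) , last≡
    where
    open ≡-Reasoning
    P = replicate (suc l) a
    N = nest (t ∷ ts)
    R = replicate (suc b) c
    last≡ : lastChar (nest ((runs l a b c , suc l) ∷ t ∷ ts)) ≡ lastChar (runs l a b c)
    last≡ = begin
      lastChar (nest ((runs l a b c , suc l) ∷ t ∷ ts)) ≡⟨ cong lastChar (nest-runs l a b c t ts) ⟩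
      lastChar (P ++ N ++ R)                              ≡⟨ cong lastChar (sym (++-assoc P N R)) ⟩
      lastChar ((P ++ N) ++ R)                            ≡⟨ lastChar-++-replicate (P ++ N) b c ⟩
      just c                                              ≡⟨ sym (lastChar-++-replicate P b c) ⟩
      lastChar (runs l a b c)                             ∎

module _ {B C : Set} {f : B → C} (f-injective : Injective _≡_ _≡_ f) where

  Cond1Tok-map : ∀ {t} → Cond1Tok t → Cond1Tok (map₁ (map f) t)
  Cond1Tok-map c1 with Cond1Tok⇒runs c1
  ... | a , c , l , b , refl =
    subst (λ σ → Cond1Tok (σ , suc l)) (sym (map-runs f (suc l) a (suc b) c)) (Cond1Tok-runs l (f a) b (f c))

  Cond2-map : ∀ {t} → Cond2 t → Cond2 (map₁ (map f) t)
  Cond2-map (p≡0 , inj₁ (a , m , 1≤m , σ≡)) =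
    p≡0 , inj₁ (f a , m , 1≤m , trans (cong (map f) σ≡) (map-replicate f m a))
  Cond2-map (p≡0 , inj₂ (a , c , l , b , a≢c , 1≤l , 1≤b , σ≡)) =
    p≡0 , inj₂ (f a , f c , l , b , (λ fa≡fc → a≢c (f-injective fa≡fc)) , 1≤l , 1≤b ,
                trans (cong (map f) σ≡) (map-runs f l a b c))

  Adjacent-map : ∀ {t t′} → Adjacent t t′ → Adjacent (map₁ (map f) t) (map₁ (map f) t′)
  Adjacent-map {σ , _} {σ′ , _} (first≢ , last≢) =
    (λ e → first≢ (Maybe.map-injective f-injective (trans (sym (first-map f σ′)) (trans e (first-map f σ))))) ,
    (λ e → last≢ (Maybe.map-injective f-injective (trans (sym (lastChar-map f σ′)) (trans e (lastChar-map f σ)))))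

  Admissible-map : ∀ {T} → Admissible T → Admissible (map (map₁ (map f)) T)
  Admissible-map (final c2) = final (Cond2-map c2)
  Admissible-map {t ∷ t′ ∷ _} (c1 ∷⟨ adj ⟩ adm) = Cond1Tok-map c1 ∷⟨ Adjacent-map {t} {t′} adj ⟩ Admissible-map adm

nest-map : ∀ {B C : Set} (f : B → C) T → nest (map (map₁ (map f)) T) ≡ map f (nest T)
nest-map f []                 = refl
nest-map f (_ ∷ [])           = refl
nest-map f ((σ , p) ∷ t ∷ ts) = begin
  take p (map f σ) ++ nest (map (map₁ (map f)) (t ∷ ts)) ++ drop p (map f σ)
    ≡⟨ cong₂ _++_ (take-map p σ) (cong₂ _++_ (nest-map f (t ∷ ts)) (drop-map p σ)) ⟩
  map f (take p σ) ++ map f (nest (t ∷ ts)) ++ map f (drop p σ)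
    ≡⟨ cong (map f (take p σ) ++_) (sym (map-++ f (nest (t ∷ ts)) (drop p σ))) ⟩
  map f (take p σ) ++ map f (nest (t ∷ ts) ++ drop p σ)
    ≡⟨ sym (map-++ f (take p σ) (nest (t ∷ ts) ++ drop p σ)) ⟩
  map f (take p σ ++ nest (t ∷ ts) ++ drop p σ) ∎
  where open ≡-Reasoning

module _ {B : Set} (_≟_ : DecidableEquality B) where

  leadingRun : (x : B) (ys : List B) → ∃[ k ] ∃[ zs ] (ys ≡ replicate k x ++ zs × first zs ≢ just x)
  leadingRun x []       = 0 , [] , refl , λ ()
  leadingRun x (y ∷ ys) with y ≟ x
  ... | yes refl = let k , zs , ys≡ , zs≢ = leadingRun x ys in suc k , zs , cong (x ∷_) ys≡ , zs≢
  ... | no y≢x   = 0 , y ∷ ys , refl , λ { refl → y≢x refl }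

  trailingRun : (zs : List B) → zs ≢ [] →
    ∃[ c ] ∃[ j ] ∃[ ws ] (zs ≡ ws ++ replicate (suc j) c × lastChar ws ≢ just c)
  trailingRun zs zs≢[] with reverse zs in rev≡
  ... | [] = ⊥-elim (zs≢[] (trans (sym (reverse-involutive zs)) (cong reverse rev≡)))
  ... | c ∷ r =
    let j , u , r≡ , u≢ = leadingRun c r
        zs≡ = begin
          zs                                ≡⟨ sym (reverse-involutive zs) ⟩
          reverse (reverse zs)              ≡⟨ cong reverse (trans rev≡ (cong (c ∷_) r≡)) ⟩
          reverse (replicate (suc j) c ++ u) ≡⟨ reverse-++ (replicate (suc j) c) u ⟩
          reverse u ++ reverse (replicate (suc j) c) ≡⟨ cong (reverse u ++_) (reverse-replicate (suc j) c) ⟩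
          reverse u ++ replicate (suc j) c  ∎
    in c , j , reverse u , zs≡ , λ e → u≢ (trans (cong first (sym (reverse-involutive u))) e)
    where open ≡-Reasoning

  data RunsView : List B → Set where
    oneRun     : ∀ a m → RunsView (replicate (suc m) a)
    twoRuns    : ∀ {a c} l b → a ≢ c → RunsView (runs l a b c)
    runsAround : ∀ {a c} l b M → M ≢ [] → first M ≢ just a → lastChar M ≢ just c →
                 RunsView (replicate (suc l) a ++ M ++ replicate (suc b) c)

  runsView : (xs : List B) → xs ≢ [] → RunsView xs
  runsView []       xs≢[] = ⊥-elim (xs≢[] refl)
  runsView (x ∷ ys) _ with leadingRun x ys
  ... | k , [] , ys≡ , _ = subst RunsView (cong (x ∷_) (sym (trans ys≡ (++-identityʳ _)))) (oneRun x k)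
  ... | k , zs@(_ ∷ _) , ys≡ , zs≢ with trailingRun zs (λ ())
  ...   | c , j , [] , zs≡ , _ =
    subst RunsView (cong (x ∷_) (sym (trans ys≡ (cong (replicate k x ++_) zs≡)))) (twoRuns k j x≢c)
    where
    x≢c : x ≢ c
    x≢c refl = zs≢ (cong first zs≡)
  ...   | c , j , ws@(_ ∷ _) , zs≡ , ws≢ =
    subst RunsView (cong (x ∷_) (sym (trans ys≡ (cong (replicate k x ++_) zs≡))))
      (runsAround k j ws (λ ()) (λ e → zs≢ (trans (cong first zs≡) e)) ws≢)

  nest-surjective : (xs : List B) → xs ≢ [] → ∃[ T ] (Admissible T × nest T ≡ xs)
  nest-surjective xs xs≢[] = go xs xs≢[] (<-wellFounded (length xs))
    where
    go : (xs : List B) → xs ≢ [] → Acc _<_ (length xs) → ∃[ T ] (Admissible T × nest T ≡ xs)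
    go xs xs≢[] (acc shorter) with runsView xs xs≢[]
    ... | oneRun a m = (replicate (suc m) a , 0) ∷ [] , final (refl , inj₁ (a , suc m , s≤s z≤n , refl)) , refl
    ... | twoRuns {a} {c} l b a≢c =
      (runs l a b c , 0) ∷ [] , final (refl , inj₂ (a , c , suc l , suc b , a≢c , s≤s z≤n , s≤s z≤n , refl)) , refl
    ... | runsAround {a} {c} l b M M≢[] first≢ last≢
      with go M M≢[] (shorter (s≤s (length-≤-infix (replicate l a) M (replicate (suc b) c))))
    ...   | (σ , p) ∷ ts , adm , nest≡M =
      (runs l a b c , suc l) ∷ (σ , p) ∷ ts ,
      Cond1Tok-runs l a b c ∷⟨ adjacent ⟩ adm ,
      trans (nest-runs l a b c (σ , p) ts) (cong (λ N → replicate (suc l) a ++ N ++ replicate (suc b) c) nest≡M)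
      where
      ends = nest-ends adm
      adjacent : Adjacent (runs l a b c , suc l) (σ , p)
      adjacent =
        (λ e → first≢ (trans (cong first (sym nest≡M)) (trans (proj₁ ends) e))) ,
        (λ e → last≢ (trans (cong lastChar (sym nest≡M))
                       (trans (proj₂ ends) (trans e (lastChar-++-replicate (replicate (suc l) a) b c)))))

hatTok : ∀ {A : Set} → Token (Sym A)
hatTok = (at ∷ dollar ∷ []) , 1

ch-injective : ∀ {A : Set} → Injective _≡_ _≡_ (ch {A})
ch-injective refl = refl

embTok-injective : ∀ {A : Set} → Injective _≡_ _≡_ (embTok {A})
embTok-injective {x = σ , p} {σ′ , p′} e = cong₂ _,_ (map-injective ch-injective (cong proj₁ e)) (cong proj₂ e)

Admissible-hat : ∀ {A : Set} {T : List (Token A)} → Admissible T → Admissible (hatTok ∷ map embTok T)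
Admissible-hat {T = (σ , p) ∷ _} adm = Cond1Tok-runs 0 at 0 dollar ∷⟨ adjacent ⟩ Admissible-map ch-injective adm
  where
  letter≢at : ∀ m → Maybe.map ch m ≢ just at
  letter≢at nothing  ()
  letter≢at (just _) ()
  letter≢dollar : ∀ m → Maybe.map ch m ≢ just dollar
  letter≢dollar nothing  ()
  letter≢dollar (just _) ()
  adjacent : Adjacent hatTok (embTok (σ , p))
  adjacent = (λ e → letter≢at (first σ) (trans (sym (first-map ch σ)) e)) ,
             (λ e → letter≢dollar (lastChar σ) (trans (sym (lastChar-map ch σ)) e))

module Flashback {A : Set} (_≟A_ : DecidableEquality A) where

  runFrom-replicate-++ : ∀ (x : Sym A) l ys → first ys ≢ just x → runFrom _≟A_ x (replicate l x ++ ys) ≡ l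
  runFrom-replicate-++ x zero    []       _    = refl
  runFrom-replicate-++ x zero    (y ∷ ys) y≢x with _≟S_ _≟A_ x y
  ... | yes refl = ⊥-elim (y≢x refl)
  ... | no _     = refl
  runFrom-replicate-++ x (suc l) ys       ys≢ with _≟S_ _≟A_ x x
  ... | yes _   = cong suc (runFrom-replicate-++ x l ys ys≢)
  ... | no x≢x = ⊥-elim (x≢x refl)

  leadLen-replicate-++ : ∀ (x : Sym A) l ys → first ys ≢ just x → leadLen _≟A_ (replicate (suc l) x ++ ys) ≡ suc l
  leadLen-replicate-++ x l ys ys≢ = cong suc (runFrom-replicate-++ x l ys ys≢)

  trailLen-++-replicate : ∀ (ys : List (Sym A)) b y → lastChar ys ≢ just y →
    trailLen _≟A_ (ys ++ replicate (suc b) y) ≡ suc b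
  trailLen-++-replicate ys b y ys≢ =
    trans (cong (leadLen _≟A_) (reverse-++-replicate ys (suc b) y)) (leadLen-replicate-++ y b (reverse ys) ys≢)

  afterPeel : ℕ → List (Sym A) → ℕ → List (Sym A) → List (Token (Sym A))
  afterPeel n σ p []          = (σ , 0) ∷ []
  afterPeel n σ p mid@(_ ∷ _) = (σ , p) ∷ decomp _≟A_ n mid

  peel : ℕ → List (Sym A) → ℕ → ℕ → List (Token (Sym A))
  peel n w ℓ t = afterPeel n (take ℓ w ++ drop (length w ∸ t) w) ℓ (drop ℓ (take (length w ∸ t) w))

  decomp-unfold : ∀ n x xs → leadLen _≟A_ (x ∷ xs) ≢ length (x ∷ xs) →
    decomp _≟A_ (suc n) (x ∷ xs) ≡ peel n (x ∷ xs) (leadLen _≟A_ (x ∷ xs)) (trailLen _≟A_ (x ∷ xs))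
  decomp-unfold n x xs lead≢ with leadLen _≟A_ (x ∷ xs) ℕ.≟ length (x ∷ xs)
  ... | yes lead≡ = ⊥-elim (lead≢ lead≡)
  ... | no _ with drop (leadLen _≟A_ (x ∷ xs)) (take (length (x ∷ xs) ∸ trailLen _≟A_ (x ∷ xs)) (x ∷ xs))
  ...   | []    = refl
  ...   | _ ∷ _ = refl

  peel-++ : ∀ n (P Q R : List (Sym A)) → peel n (P ++ Q ++ R) (length P) (length R) ≡ afterPeel n (P ++ R) (length P) Q
  peel-++ n P Q R = cong₂ (λ σ mid → afterPeel n σ (length P) mid) (cong₂ _++_ (take-length-++ P (Q ++ R)) back) middle
    where
    open ≡-Reasoning
    W = P ++ Q ++ R
    W≡ : W ≡ (P ++ Q) ++ R
    W≡ = sym (++-assoc P Q R)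
    cut : length W ∸ length R ≡ length (P ++ Q)
    cut = trans (cong (λ w → length w ∸ length R) W≡) (length-++-∸ (P ++ Q) R)
    back : drop (length W ∸ length R) W ≡ R
    back = trans (cong₂ drop cut W≡) (drop-length-++ (P ++ Q) R)
    middle : drop (length P) (take (length W ∸ length R) W) ≡ Q
    middle = begin
      drop (length P) (take (length W ∸ length R) W)             ≡⟨ cong (drop (length P)) (cong₂ take cut W≡) ⟩
      drop (length P) (take (length (P ++ Q)) ((P ++ Q) ++ R))   ≡⟨ cong (drop (length P)) (take-length-++ (P ++ Q) R) ⟩
      drop (length P) (P ++ Q)                                   ≡⟨ drop-length-++ P Q ⟩
      Q                                                          ∎

  decomp-runs : ∀ n (x y : Sym A) l b Q →
    first (Q ++ replicate (suc b) y) ≢ just x → lastChar (replicate (suc l) x ++ Q) ≢ just y →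
    decomp _≟A_ (suc n) (replicate (suc l) x ++ Q ++ replicate (suc b) y) ≡ afterPeel n (runs l x b y) (suc l) Q
  decomp-runs n x y l b Q first≢ last≢ = begin
    decomp _≟A_ (suc n) W                          ≡⟨ decomp-unfold n x (replicate l x ++ Q ++ R) lead≢length ⟩
    peel n W (leadLen _≟A_ W) (trailLen _≟A_ W)    ≡⟨ cong₂ (peel n W) lead trail ⟩
    peel n W (length P) (length R)                 ≡⟨ peel-++ n P Q R ⟩
    afterPeel n (P ++ R) (length P) Q              ≡⟨ cong (λ k → afterPeel n (P ++ R) k Q) (length-replicate (suc l)) ⟩
    afterPeel n (P ++ R) (suc l) Q                 ∎
    where
    open ≡-Reasoning
    P = replicate (suc l) x
    R = replicate (suc b) y
    W = P ++ Q ++ R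
    lead : leadLen _≟A_ W ≡ length P
    lead = trans (leadLen-replicate-++ x l (Q ++ R) first≢) (sym (length-replicate (suc l)))
    trail : trailLen _≟A_ W ≡ length R
    trail = trans (cong (trailLen _≟A_) (sym (++-assoc P Q R)))
                  (trans (trailLen-++-replicate (P ++ Q) b y last≢) (sym (length-replicate (suc b))))
    P<W : length P < length W
    P<W = subst (length P <_) (sym (length-++ P)) (m<m+n (length P) (≤-trans (s≤s z≤n) (length-++-≤ʳ R {Q})))
    lead≢length : leadLen _≟A_ W ≢ length W
    lead≢length e = <⇒≢ P<W (trans (sym lead) e)

  decomp-run : ∀ n (x : Sym A) m → decomp _≟A_ (suc n) (replicate (suc m) x) ≡ (replicate (suc m) x , 0) ∷ []
  decomp-run n x m with leadLen _≟A_ (replicate (suc m) x) ℕ.≟ length (replicate (suc m) x)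
  ... | yes _            = refl
  ... | no lead≢length = ⊥-elim (lead≢length (trans lead (sym (length-replicate (suc m)))))
    where
    lead : leadLen _≟A_ (replicate (suc m) x) ≡ suc m
    lead = trans (cong (leadLen _≟A_) (sym (++-identityʳ (replicate (suc m) x)))) (leadLen-replicate-++ x m [] λ ())

  decomp-two-runs : ∀ n {x y : Sym A} l b → x ≢ y → decomp _≟A_ (suc n) (runs l x b y) ≡ (runs l x b y , 0) ∷ []
  decomp-two-runs n {x} {y} l b x≢y = decomp-runs n x y l b [] (λ { refl → x≢y refl }) last≢
    where
    last≢ : lastChar (replicate (suc l) x ++ []) ≢ just y
    last≢ e = x≢y (Maybe.just-injective (trans (sym (lastChar-++-replicate [] l x))
                    (trans (cong lastChar (sym (++-identityʳ (replicate (suc l) x)))) e)))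

  decomp-runs-around : ∀ n {x y : Sym A} l b Q → Q ≢ [] → first Q ≢ just x → lastChar Q ≢ just y →
    decomp _≟A_ (suc n) (replicate (suc l) x ++ Q ++ replicate (suc b) y) ≡ (runs l x b y , suc l) ∷ decomp _≟A_ n Q
  decomp-runs-around n l b []       Q≢[] _ _ = ⊥-elim (Q≢[] refl)
  decomp-runs-around n {x} {y} l b (q ∷ qs) _ first≢ last≢ =
    decomp-runs n x y l b (q ∷ qs) first≢ (λ e → last≢ (trans (sym (lastChar-++ (replicate (suc l) x) (q ∷ qs) λ ())) e))

  decomp-nest : ∀ {n T} → Admissible T → length (nest T) ≤ n → decomp _≟A_ n (nest T) ≡ T
  decomp-nest {zero}  (final (_ , inj₁ (_ , suc _ , _ , refl))) ()
  decomp-nest {suc n} (final (refl , inj₁ (a , suc m , _ , refl))) _ = decomp-run n a m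
  decomp-nest {zero}  (final (_ , inj₂ (_ , _ , suc _ , suc _ , _ , _ , _ , refl))) ()
  decomp-nest {suc n} (final (refl , inj₂ (_ , _ , suc l , suc b , a≢c , _ , _ , refl))) _ = decomp-two-runs n l b a≢c
  decomp-nest {n} {_ ∷ t ∷ ts} (c1 ∷⟨ first≢ , last≢ ⟩ adm) fuel with Cond1Tok⇒runs c1
  ... | a , c , l , b , refl =
    trans (cong (decomp _≟A_ n) (nest-runs l a b c t ts)) (peeled n (subst (_≤ n) (cong length (nest-runs l a b c t ts)) fuel))
    where
    N = nest (t ∷ ts)
    ends = nest-ends adm
    first-N≢ : first N ≢ just a
    first-N≢ e = first≢ (trans (sym (proj₁ ends)) e)
    last-N≢ : lastChar N ≢ just c
    last-N≢ e = last≢ (trans (sym (proj₂ ends)) (trans e (sym (lastChar-++-replicate (replicate (suc l) a) b c))))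
    peeled : ∀ n → length (replicate (suc l) a ++ N ++ replicate (suc b) c) ≤ n →
      decomp _≟A_ n (replicate (suc l) a ++ N ++ replicate (suc b) c) ≡ (runs l a b c , suc l) ∷ t ∷ ts
    peeled (suc n) (s≤s fuel) =
      trans (decomp-runs-around n l b N (nest-nonempty adm) first-N≢ last-N≢)
            (cong (_ ∷_) (decomp-nest adm (≤-trans (length-≤-infix (replicate l a) N (replicate (suc b) c)) fuel)))

  Fsym-nest : ∀ {t ts} → Admissible (hatTok ∷ t ∷ ts) → Fsym _≟A_ (nest (t ∷ ts)) ≡ hatTok ∷ t ∷ ts
  Fsym-nest adm = decomp-nest adm ≤-refl  -- nest (hatTok ∷ t ∷ ts) computes to hat (nest (t ∷ ts))

  F-nest : ∀ {T} → Admissible T → F _≟A_ (nest T) ≡ hatTok ∷ map embTok T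
  F-nest {T@(_ ∷ _)} adm = trans (cong (Fsym _≟A_) (sym (nest-map ch T))) (Fsym-nest (Admissible-hat adm))

  Fsym-Finv : ∀ {T} → Admissible T → Fsym _≟A_ (Finv (hatTok ∷ map embTok T)) ≡ hatTok ∷ map embTok T
  Fsym-Finv {T@(_ ∷ _)} adm =
    trans (cong (Fsym _≟A_) (dropLast-∷ʳ (nest (map embTok T)) dollar)) (Fsym-nest (Admissible-hat adm))

  F-image-Admissible : ∀ s T → F _≟A_ s ≡ hatTok ∷ map embTok T → Admissible T
  F-image-Admissible []      T ()  -- 𝓕 [] = [(@$,0)]
  F-image-Admissible (x ∷ s) T F≡ =
    let T₀ , adm , nest≡ = nest-surjective _≟A_ (x ∷ s) (λ ())
        F≡₀ = trans (sym (F-nest adm)) (trans (cong (F _≟A_) nest≡) F≡)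
    in subst Admissible (map-injective embTok-injective (∷-injectiveʳ F≡₀)) adm

mainTheorem13 : {A : Set} (_≟_ : DecidableEquality A)
    (mids : List (Token A)) (lastTok : Token A) →
    All NonEmptyTok (mids ++ [ lastTok ]) →
    ((∃[ s ] (F _≟_ s ≡ tokSeq mids lastTok)) ⇔ Conds mids lastTok)
    × (Conds mids lastTok → Fsym _≟_ (Finv (tokSeq mids lastTok)) ≡ tokSeq mids lastTok)
mainTheorem13 _≟_ mids lastTok _ =  -- non-emptiness of the tokens follows from the conditions
  mk⇔ (λ (s , F≡) → Admissible⇒Conds mids lastTok (F-image-Admissible s (mids ++ [ lastTok ]) F≡))
      (λ conds → nest (mids ++ [ lastTok ]) , F-nest (Conds⇒Admissible mids lastTok conds)) ,
  λ conds → Fsym-Finv (Conds⇒Admissible mids lastTok conds)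
  where open Flashback _≟_
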